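{- Let $H$ be a finite loopless multigraph containing an EQ-gadget with terminals $x$ and $y$. Then in every FO2-coloring of $H$, the vertices $x$ and $y$ receive the same color.
   Context: Multigraphs may have parallel edges but no loops. A functional orientation of $H$ is an assignment of directions to a set of edges such that every vertex of positive degree has exactly one edge directed away from it; an edge may be assigned both directions or remain undirected. A 2-coloring is a partition of $V(H)$ into two color classes (not necessarily independent). An FO2-coloring of $H$ is a 2-coloring for which some functional orientation directs every edge whose endpoints have the same color in at least one direction. An EQ-gadget with terminals $x,y$ consists of nine distinct vertices $x,y,\gamma,\alpha,\beta,a,b,c,d$ and the following edges: two parallel edges $x\gamma$, two parallel edges $y\gamma$, single edges $\gamma\alpha$, $\alpha\beta$, $\beta\gamma$, two parallel edges $\alpha a$, two parallel edges $\alpha b$, three parallel edges $ab$, two parallel edges $\beta c$, two parallel edges $\beta d$, and three parallel edges $cd$. $H$ contains this gadget if all these vertices and edges belong to $H$ and the non-terminal vertices $\gamma,\alpha,\beta,a,b,c,d$ are incident in $H$ to no edges other than the listed ones (the terminals $x,y$ may have further edges in $H$). -}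

module Defs where

open import Data.Nat using (ℕ)
open import Data.Fin using (Fin)
open import Data.Bool using (Bool)
open import Data.Product using (_×_; _,_; proj₁; proj₂; ∃; Σ-syntax; ∃-syntax)
open import Data.Sum using (_⊎_)
open import Data.Empty using (⊥)
open import Data.Unit using (⊤)
open import Data.Vec using (Vec; []; _∷_; lookup)
open import Relation.Nullary using (¬_)
open import Relation.Binary.PropositionalEquality using (_≡_; _≢_)
open import Function.Definitions using (Injective)

-- A finite loopless multigraph: vertices Fin n, edges Fin m, each edge
-- has two (ordered, for bookkeeping only) distinct endpoints.
-- Parallel edges are distinct edge indices with the same endpoints.
record Multigraph : Set where
  field
    n     : ℕ
    m     : ℕ
    ends  : Fin m → Fin n × Fin n
    loopless : ∀ e → proj₁ (ends e) ≢ proj₂ (ends e)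

open Multigraph public

module _ (H : Multigraph) where
  Vtx : Set
  Vtx = Fin (n H)

  Edge : Set
  Edge = Fin (m H)

  src tgt : Edge → Vtx
  src e = proj₁ (ends H e)
  tgt e = proj₂ (ends H e)

  Incident : Edge → Vtx → Set
  Incident e v = (src e ≡ v) ⊎ (tgt e ≡ v)

  PositiveDegree : Vtx → Set
  PositiveDegree v = ∃[ e ] Incident e v

-- Directions assignable to an edge: undirected, src→tgt, tgt→src, or both.
data Dir : Set where
  none fwd bwd both : Dir

HasFwd : Dir → Set
HasFwd fwd  = ⊤
HasFwd both = ⊤
HasFwd _    = ⊥

HasBwd : Dir → Set
HasBwd bwd  = ⊤
HasBwd both = ⊤
HasBwd _    = ⊥

Directed : Dir → Set
Directed none = ⊥
Directed _    = ⊤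

module _ (H : Multigraph) where
  Orientation : Set
  Orientation = Edge H → Dir

  AwayFrom : Orientation → Edge H → Vtx H → Set
  AwayFrom O e v = (src H e ≡ v × HasFwd (O e)) ⊎ (tgt H e ≡ v × HasBwd (O e))

  IsFunctional : Orientation → Set
  IsFunctional O = ∀ v → PositiveDegree H v →
    Σ[ e ∈ Edge H ] (AwayFrom O e v × (∀ e′ → AwayFrom O e′ v → e′ ≡ e))

  Coloring : Set
  Coloring = Vtx H → Bool

  IsFO2Coloring : Coloring → Set
  IsFO2Coloring col = Σ[ O ∈ Orientation ] (IsFunctional O ×
    (∀ e → col (src H e) ≡ col (tgt H e) → Directed (O e)))

data GV : Set where
  gx gy gγ gα gβ ga gb gc gd : GV

NonTerminal : GV → Set
NonTerminal gx = ⊥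
NonTerminal gy = ⊥
NonTerminal _  = ⊤

gadgetEdges : Vec (GV × GV) 21
gadgetEdges =
  (gx , gγ) ∷ (gx , gγ) ∷
  (gy , gγ) ∷ (gy , gγ) ∷
  (gγ , gα) ∷ (gα , gβ) ∷ (gβ , gγ) ∷
  (gα , ga) ∷ (gα , ga) ∷
  (gα , gb) ∷ (gα , gb) ∷
  (ga , gb) ∷ (ga , gb) ∷ (ga , gb) ∷
  (gβ , gc) ∷ (gβ , gc) ∷
  (gβ , gd) ∷ (gβ , gd) ∷
  (gc , gd) ∷ (gc , gd) ∷ (gc , gd) ∷ []

module _ (H : Multigraph) where
  Joins : Edge H → Vtx H → Vtx H → Set
  Joins e u w = (ends H e ≡ (u , w)) ⊎ (ends H e ≡ (w , u))

  ContainsEQGadget : Vtx H → Vtx H → Set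
  ContainsEQGadget x y =
    Σ[ φ ∈ (GV → Vtx H) ] Σ[ ψ ∈ (Fin 21 → Edge H) ]
      ( Injective _≡_ _≡_ φ
      × φ gx ≡ x × φ gy ≡ y
      × Injective _≡_ _≡_ ψ
      × (∀ i → Joins (ψ i) (φ (proj₁ (lookup gadgetEdges i))) (φ (proj₂ (lookup gadgetEdges i))))
      × (∀ (k : GV) → NonTerminal k → ∀ (e : Edge H) → Incident H e (φ k) → ∃[ i ] ψ i ≡ e))

module Submission where

-- Every vertex of positive degree has a unique out-edge, and
-- every monochromatic edge is directed, hence leaves one of its endpoints.
-- From these two facts we derive local rules for general multigraphs:
--   * a triple edge is bichromatic;
--   * a monochromatic double edge carries the out-edge of each endpoint;
--   * an edge whose endpoints both send their out-edge elsewhere, or a double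
--     edge to a vertex sending its out-edge elsewhere, is bichromatic.
-- In the gadget, the pendant triangles at α and β force the out-edges of α
-- and β into those triangles, so αβ is bichromatic; γ agrees in colour with
-- α or β and therefore sends its out-edge along γα or γβ.  Hence the double
-- edges xγ and yγ are bichromatic, so x and y both differ from γ in colour
-- and must agree with each other.

open import Defs
open import Relation.Binary.PropositionalEquality using (_≡_; _≢_; refl; sym; trans; cong)
open import Data.Bool using (Bool; _≟_)
open import Data.Bool.Properties using (¬-not)
open import Data.Fin using (Fin; #_)
open import Data.Product using (_×_; _,_; proj₁; proj₂; Σ-syntax)
open import Data.Sum using (_⊎_; inj₁; inj₂; [_,_])
open import Data.Empty using (⊥-elim)
open import Data.Unit using (tt)
open import Relation.Nullary using (¬_; yes; no)
open import Function using (_∘_)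

bool-dichotomy : {p q r : Bool} → p ≢ q → r ≡ p ⊎ r ≡ q
bool-dichotomy {p} {q} {r} p≢q with r ≟ p
... | yes r≡p = inj₁ r≡p
... | no  r≢p = inj₂ (trans (¬-not r≢p) (sym (¬-not (p≢q ∘ sym))))

bool-both-differ : {p q r : Bool} → p ≢ r → q ≢ r → p ≡ q
bool-both-differ p≢r q≢r = trans (¬-not p≢r) (sym (¬-not q≢r))

module FO2Rules (H : Multigraph) (col : Coloring H) (O : Orientation H)
  (functional : IsFunctional H O)
  (mono-directed : ∀ e → col (src H e) ≡ col (tgt H e) → Directed (O e)) where

  Away : Edge H → Vtx H → Set
  Away = AwayFrom H O

  -- A vertex with an edge leaving it has positive degree, so its out-edge is unique.
  away-unique : ∀ {e e′ v} → Away e v → Away e′ v → e ≡ e′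
  away-unique {e} {e′} {v} a a′ with functional v (e , incident a)
    where
    incident : Away e v → Incident H e v
    incident (inj₁ (p , _)) = inj₁ p
    incident (inj₂ (p , _)) = inj₂ p
  ... | _ , _ , unique = trans (unique e a) (sym (unique e′ a′))

  OutEdgeIn : Vtx H → (Edge H → Set) → Set
  OutEdgeIn v P = Σ[ e ∈ Edge H ] (Away e v × P e)

  not-away : ∀ {v P e} → OutEdgeIn v P → ¬ P e → ¬ Away e v
  not-away (e′ , a′ , Pe′) ¬Pe a with away-unique a a′
  ... | refl = ¬Pe Pe′

  joins-sym : ∀ {e u w} → Joins H e u w → Joins H e w u
  joins-sym (inj₁ p) = inj₂ p
  joins-sym (inj₂ p) = inj₁ p

  directed-away : ∀ {e u w} → Joins H e u w → Directed (O e) → Away e u ⊎ Away e w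
  directed-away {e} (inj₁ p) d with O e | d
  ... | fwd  | _ = inj₁ (inj₁ (cong proj₁ p , tt))
  ... | bwd  | _ = inj₂ (inj₂ (cong proj₂ p , tt))
  ... | both | _ = inj₁ (inj₁ (cong proj₁ p , tt))
  directed-away {e} (inj₂ p) d with O e | d
  ... | fwd  | _ = inj₂ (inj₁ (cong proj₁ p , tt))
  ... | bwd  | _ = inj₁ (inj₂ (cong proj₂ p , tt))
  ... | both | _ = inj₂ (inj₁ (cong proj₁ p , tt))

  mono-away : ∀ {e u w} → Joins H e u w → col u ≡ col w → Away e u ⊎ Away e w
  mono-away {e} {u} {w} j c = directed-away j (mono-directed e (same-ends j))
    where
    same-ends : Joins H e u w → col (src H e) ≡ col (tgt H e)
    same-ends (inj₁ p) = trans (cong (col ∘ proj₁) p) (trans c (sym (cong (col ∘ proj₂) p)))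
    same-ends (inj₂ p) = trans (cong (col ∘ proj₁) p) (trans (sym c) (sym (cong (col ∘ proj₂) p)))

  mono-toward : ∀ {e u w} → Joins H e u w → col u ≡ col w → ¬ Away e w → Away e u
  mono-toward j c ¬a with mono-away j c
  ... | inj₁ a = a
  ... | inj₂ a = ⊥-elim (¬a a)

  -- Three parallel edges cannot all be monochromatic: two of them would
  -- leave the same endpoint.
  triple-bichromatic : ∀ {e₁ e₂ e₃ u w} →
    Joins H e₁ u w → Joins H e₂ u w → Joins H e₃ u w →
    e₁ ≢ e₂ → e₁ ≢ e₃ → e₂ ≢ e₃ → col u ≢ col w
  triple-bichromatic j₁ j₂ j₃ n₁₂ n₁₃ n₂₃ c
    with mono-away j₁ c | mono-away j₂ c | mono-away j₃ c
  ... | inj₁ a₁ | inj₁ a₂ | _       = n₁₂ (away-unique a₁ a₂)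
  ... | inj₂ a₁ | inj₂ a₂ | _       = n₁₂ (away-unique a₁ a₂)
  ... | inj₁ a₁ | inj₂ _  | inj₁ a₃ = n₁₃ (away-unique a₁ a₃)
  ... | inj₂ a₁ | inj₁ _  | inj₂ a₃ = n₁₃ (away-unique a₁ a₃)
  ... | inj₂ _  | inj₁ a₂ | inj₁ a₃ = n₂₃ (away-unique a₂ a₃)
  ... | inj₁ _  | inj₂ a₂ | inj₂ a₃ = n₂₃ (away-unique a₂ a₃)

  double-mono-out : ∀ {e₁ e₂ u w} → Joins H e₁ u w → Joins H e₂ u w → e₁ ≢ e₂ →
    col u ≡ col w → OutEdgeIn u (λ e → e ≡ e₁ ⊎ e ≡ e₂)
  double-mono-out {e₁} {e₂} j₁ j₂ n c with mono-away j₁ c | mono-away j₂ c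
  ... | inj₁ a₁ | _       = e₁ , a₁ , inj₁ refl
  ... | inj₂ _  | inj₁ a₂ = e₂ , a₂ , inj₂ refl
  ... | inj₂ a₁ | inj₂ a₂ = ⊥-elim (n (away-unique a₁ a₂))

  anchored-ends-bichromatic : ∀ {e u w P Q} → Joins H e u w →
    OutEdgeIn u P → ¬ P e → OutEdgeIn w Q → ¬ Q e → col u ≢ col w
  anchored-ends-bichromatic j outU ¬Pe outW ¬Qe c with mono-away j c
  ... | inj₁ a = not-away outU ¬Pe a
  ... | inj₂ a = not-away outW ¬Qe a

  -- A double edge towards a vertex sending its out-edge elsewhere is
  -- bichromatic: if monochromatic, both edges would leave the other end.
  double-anchored-bichromatic : ∀ {e₁ e₂ u w P} →
    Joins H e₁ u w → Joins H e₂ u w → e₁ ≢ e₂ →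
    OutEdgeIn w P → ¬ P e₁ → ¬ P e₂ → col u ≢ col w
  double-anchored-bichromatic j₁ j₂ n outW ¬P₁ ¬P₂ c =
    n (away-unique (mono-toward j₁ c (not-away outW ¬P₁))
                   (mono-toward j₂ c (not-away outW ¬P₂)))

  -- Pendant triangle: double edges va, vb and a triple edge ab.  Since ab is
  -- bichromatic, v agrees in colour with a or b, and the corresponding
  -- double edge carries the out-edge of v.
  pendant-triangle-out : ∀ {v a b f₁ f₂ g₁ g₂ h₁ h₂ h₃} →
    Joins H f₁ v a → Joins H f₂ v a → f₁ ≢ f₂ →
    Joins H g₁ v b → Joins H g₂ v b → g₁ ≢ g₂ →
    Joins H h₁ a b → Joins H h₂ a b → Joins H h₃ a b →
    h₁ ≢ h₂ → h₁ ≢ h₃ → h₂ ≢ h₃ →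
    OutEdgeIn v (λ e → (e ≡ f₁ ⊎ e ≡ f₂) ⊎ (e ≡ g₁ ⊎ e ≡ g₂))
  pendant-triangle-out jf₁ jf₂ nf jg₁ jg₂ ng jh₁ jh₂ jh₃ n₁₂ n₁₃ n₂₃
    with bool-dichotomy (triple-bichromatic jh₁ jh₂ jh₃ n₁₂ n₁₃ n₂₃)
  ... | inj₁ va with double-mono-out jf₁ jf₂ nf va
  ...   | e , a , which = e , a , inj₁ which
  pendant-triangle-out jf₁ jf₂ nf jg₁ jg₂ ng jh₁ jh₂ jh₃ n₁₂ n₁₃ n₂₃
      | inj₂ vb with double-mono-out jg₁ jg₂ ng vb
  ...   | e , a , which = e , a , inj₂ which

  bichromatic-pair-out : ∀ {e e′ u w w′ P Q} →
    Joins H e u w → Joins H e′ u w′ → col w ≢ col w′ →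
    OutEdgeIn w P → ¬ P e → OutEdgeIn w′ Q → ¬ Q e′ →
    OutEdgeIn u (λ f → f ≡ e ⊎ f ≡ e′)
  bichromatic-pair-out {e} {e′} j j′ w≢w′ outW ¬Pe outW′ ¬Qe′
    with bool-dichotomy w≢w′
  ... | inj₁ uw  = e  , mono-toward j  uw  (not-away outW  ¬Pe)  , inj₁ refl
  ... | inj₂ uw′ = e′ , mono-toward j′ uw′ (not-away outW′ ¬Qe′) , inj₂ refl

lemma5 : (H : Multigraph) (x y : Vtx H) → ContainsEQGadget H x y →
         (col : Coloring H) → IsFO2Coloring H col → col x ≡ col y
lemma5 H _ _ (φ , ψ , _ , refl , refl , ψ-inj , J , _) col (O , functional , mono-directed) =
  bool-both-differ x≢γ y≢γ
  where
  open FO2Rules H col O functional mono-directed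

  distinct : ∀ {i j : Fin 21} → i ≢ j → ψ i ≢ ψ j
  distinct i≢j = i≢j ∘ ψ-inj

  outα : OutEdgeIn (φ gα) (λ e → (e ≡ ψ (# 7) ⊎ e ≡ ψ (# 8)) ⊎ (e ≡ ψ (# 9) ⊎ e ≡ ψ (# 10)))
  outα = pendant-triangle-out (J (# 7)) (J (# 8)) (distinct (λ ())) (J (# 9)) (J (# 10)) (distinct (λ ()))
           (J (# 11)) (J (# 12)) (J (# 13)) (distinct (λ ())) (distinct (λ ())) (distinct (λ ()))
  outβ : OutEdgeIn (φ gβ) (λ e → (e ≡ ψ (# 14) ⊎ e ≡ ψ (# 15)) ⊎ (e ≡ ψ (# 16) ⊎ e ≡ ψ (# 17)))
  outβ = pendant-triangle-out (J (# 14)) (J (# 15)) (distinct (λ ())) (J (# 16)) (J (# 17)) (distinct (λ ()))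
           (J (# 18)) (J (# 19)) (J (# 20)) (distinct (λ ())) (distinct (λ ())) (distinct (λ ()))

  α≢β : col (φ gα) ≢ col (φ gβ)
  α≢β = anchored-ends-bichromatic (J (# 5))
          outα [ [ distinct (λ ()) , distinct (λ ()) ] , [ distinct (λ ()) , distinct (λ ()) ] ]
          outβ [ [ distinct (λ ()) , distinct (λ ()) ] , [ distinct (λ ()) , distinct (λ ()) ] ]

  outγ : OutEdgeIn (φ gγ) (λ e → e ≡ ψ (# 4) ⊎ e ≡ ψ (# 6))
  outγ = bichromatic-pair-out (J (# 4)) (joins-sym (J (# 6))) α≢β
           outα [ [ distinct (λ ()) , distinct (λ ()) ] , [ distinct (λ ()) , distinct (λ ()) ] ]
           outβ [ [ distinct (λ ()) , distinct (λ ()) ] , [ distinct (λ ()) , distinct (λ ()) ] ]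

  x≢γ : col (φ gx) ≢ col (φ gγ)
  x≢γ = double-anchored-bichromatic (J (# 0)) (J (# 1)) (distinct (λ ()))
          outγ [ distinct (λ ()) , distinct (λ ()) ] [ distinct (λ ()) , distinct (λ ()) ]

  y≢γ : col (φ gy) ≢ col (φ gγ)
  y≢γ = double-anchored-bichromatic (J (# 2)) (J (# 3)) (distinct (λ ()))
          outγ [ distinct (λ ()) , distinct (λ ()) ] [ distinct (λ ()) , distinct (λ ()) ]
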